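{- Let $G$ be a finite digraph and $P$ a finite poset. If $\mathrm{length}(G)+1\le |A(P)|$, then the 2-walks (edges) of $G$ can be $P$-colored.
   Context: A digraph has finite vertex set and edges that are ordered pairs of distinct vertices; write $u\to v$ for an edge. A walk of length $L$ is a sequence $(v_1\dots v_{L+1})$ with $v_1\to\dots\to v_{L+1}$. $\mathrm{length}(G)$ is the maximum length of a walk in $G$, and $\mathrm{length}(G)=\infty$ if $G$ has a directed cycle. A $P$-coloring of the 2-walks is a map $c$ from edges to $P$ with $c(v_1v_2)\not\le c(v_2v_3)$ whenever $v_1\to v_2\to v_3$. $A(P)$ is the set of all antichains of $P$ (including the empty one). -}

module Defs where

open import Level using (0ℓ)
open import Data.Nat using (ℕ; zero; suc)
open import Data.Bool using (Bool; true; false; T)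
open import Data.Fin using (Fin; inject₁) renaming (suc to fsuc)
open import Data.Fin.Subset using (Subset; _∈_; inside; outside)
open import Data.Fin.Subset.Properties using (_∈?_)
open import Data.Fin.Properties using (all?; _≟_)
open import Data.Vec using (_∷_; [])
open import Data.List using (List; []; _∷_; map; _++_; filter; length)
open import Data.Product using (Σ)
open import Relation.Nullary using (¬_; Dec; yes; no)
open import Relation.Nullary.Decidable using (¬?; _→-dec_)
open import Relation.Binary using (Rel; Decidable; IsPartialOrder)
open import Relation.Binary.PropositionalEquality using (_≡_; _≢_)

record Digraph : Set where
  field
    n     : ℕ
    adj   : Fin n → Fin n → Bool
    loopless : ∀ v → adj v v ≡ false

  Vertex : Set
  Vertex = Fin n

  _⇒_ : Vertex → Vertex → Set
  u ⇒ v = T (adj u v)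

open Digraph public

Walk : (G : Digraph) → ℕ → Set
Walk G L = Σ (Fin (suc L) → Vertex G)
             (λ v → ∀ (i : Fin L) → _⇒_ G (v (inject₁ i)) (v (fsuc i)))

record FinPoset : Set₁ where
  field
    m     : ℕ
    _⊑_   : Rel (Fin m) 0ℓ
    isPartialOrder : IsPartialOrder _≡_ _⊑_
    _⊑?_  : Decidable _⊑_

open FinPoset public

IsAntichain : (P : FinPoset) → Subset (m P) → Set
IsAntichain P s = ∀ i j → i ∈ s → j ∈ s → i ≢ j → ¬ (_⊑_ P i j)

isAntichain? : (P : FinPoset) → (s : Subset (m P)) → Dec (IsAntichain P s)
isAntichain? P s =
  all? λ i → all? λ j →
    (i ∈? s) →-dec ((j ∈? s) →-dec (¬? (i ≟ j) →-dec ¬? (_⊑?_ P i j)))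

allSubsets : (k : ℕ) → List (Subset k)
allSubsets zero    = [] ∷ []
allSubsets (suc k) = map (inside ∷_) (allSubsets k) ++ map (outside ∷_) (allSubsets k)

-- |A(P)|: the number of antichains of P (including the empty one).
numAntichains : FinPoset → ℕ
numAntichains P = length (filter (isAntichain? P) (allSubsets (m P)))

IsPColoring : (G : Digraph) (P : FinPoset) →
              (∀ u v → _⇒_ G u v → Fin (m P)) → Set
IsPColoring G P c =
  ∀ u v w (e₁ : _⇒_ G u v) (e₂ : _⇒_ G v w) → ¬ (_⊑_ P (c u v e₁) (c v w e₂))

PColorable : Digraph → FinPoset → Set
PColorable G P = Σ (∀ u v → _⇒_ G u v → Fin (m P)) (IsPColoring G P)

{-# OPTIONS --safe #-}
module Submission where

-- Sending an antichain to its up-closure is injective, so P has at least |A(P)|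
-- up-sets; in the order in which allSubsets lists them, no up-set is contained in
-- a later one.  Let h v be the length of a longest walk from v: then h v < |A(P)|
-- and h strictly decreases along edges.  Labelling v by the up-set U v with index
-- h v thus gives U v ⊈ U u for every edge u → v, and the edge is coloured by some
-- element of U v ∖ U u.  For u → v → w the colour of uv lies in U v and that of vw
-- does not, so the first cannot lie below the second, U v being an up-set.

open import Defs
open import Data.Nat using (ℕ; zero; suc; _≤_; _<_; z≤n; s≤s; s<s⁻¹)
open import Data.Nat.Properties using (≤-trans; <⇒≤; ≮⇒≥; <-≤-trans)
open import Data.Bool.Properties using (T?)
open import Data.Fin as Fin using (Fin; inject₁; fromℕ<) renaming (zero to fzero; suc to fsuc)
open import Data.Fin.Properties using (any?; all?; _≟_; pigeonhole; toℕ-fromℕ<)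
open import Data.Fin.Subset using (Subset; _∈_; _∉_; _⊆_; _⊈_; inside; outside)
open import Data.Fin.Subset.Properties using (_∈?_; ⊆-antisym; ⊆-reflexive; drop-∷-⊆)
open import Data.Vec as Vec using (_∷_; here; tabulate)
open import Data.Vec.Properties using (lookup∘tabulate; []=⇒lookup; lookup⇒[]=)
open import Data.List using (List; map; filter; length; lookup; allFin)
open import Data.List.Extrema.Nat using (max; argmax-all; xs≤max)
open import Data.List.Relation.Unary.All as All using (All)
open import Data.List.Relation.Unary.All.Properties as All using (all-filter)
open import Data.List.Relation.Unary.AllPairs as AllPairs using (AllPairs)
import Data.List.Relation.Unary.AllPairs.Properties as AllPairs
open import Data.List.Relation.Unary.Any as Any using (index)
open import Data.List.Membership.Propositional using () renaming (_∈_ to _∈ˡ_)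
open import Data.List.Membership.Propositional.Properties
  using (∈-map⁺; ∈-++⁺ˡ; ∈-++⁺ʳ; ∈-filter⁺; ∈-filter⁻; ∈-lookup; ∈-allFin)
open import Data.List.Membership.Setoid.Properties using (index-injective)
open import Data.Product using (_×_; _,_; proj₁; proj₂; ∃)
open import Data.Empty using (⊥-elim)
open import Function using (_∘_; id)
open import Relation.Nullary using (Dec; yes; no; does; contradiction)
open import Relation.Nullary.Decidable using (_×-dec_; _→-dec_; ¬?; decidable-stable; dec-true)
open import Relation.Unary using (Pred; Decidable)
open import Relation.Binary using (IsPartialOrder)
open import Relation.Binary.PropositionalEquality
  using (_≡_; _≢_; refl; sym; trans; subst; subst₂; setoid)

private
  variable
    A B : Set
    k : ℕ

AllPairs-lookup : ∀ {R : A → A → Set} {xs : List A} → AllPairs R xs →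
                  ∀ {i j} → i Fin.< j → R (lookup xs i) (lookup xs j)
AllPairs-lookup (Rx  AllPairs.∷ _)   {fzero}  {fsuc j} _ = All.lookup Rx (∈-lookup j)
AllPairs-lookup (_   AllPairs.∷ Rxs) {fsuc i} {fsuc j} i<j = AllPairs-lookup Rxs (s<s⁻¹ i<j)

length-≤-injection : ∀ {xs : List A} {ys : List B} (f : A → B) → AllPairs _≢_ xs →
                     (∀ {x} → x ∈ˡ xs → f x ∈ˡ ys) →
                     (∀ {x y} → x ∈ˡ xs → y ∈ˡ xs → f x ≡ f y → x ≡ y) →
                     length xs ≤ length ys
length-≤-injection f distinct f∈ys f-injective = ≮⇒≥ λ ys<xs →
  let i , j , i<j , same = pigeonhole ys<xs (index ∘ f∈ys ∘ ∈-lookup) in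
  AllPairs-lookup distinct i<j
    (f-injective (∈-lookup i) (∈-lookup j)
      (index-injective (setoid _) (f∈ys (∈-lookup i)) (f∈ys (∈-lookup j)) same))

toSubset : ∀ {ℓ} {Q : Pred (Fin k) ℓ} → Decidable Q → Subset k
toSubset Q? = tabulate (does ∘ Q?)

module _ {ℓ} {Q : Pred (Fin k) ℓ} (Q? : Decidable Q) where

  ∈-toSubset⁺ : ∀ {x} → Q x → x ∈ toSubset Q?
  ∈-toSubset⁺ {x} Qx = lookup⇒[]= x _ (trans (lookup∘tabulate (does ∘ Q?) x) (dec-true (Q? x) Qx))

  ∈-toSubset⁻ : ∀ {x} → x ∈ toSubset Q? → Q x
  ∈-toSubset⁻ {x} x∈ with Q? x | trans (sym (lookup∘tabulate (does ∘ Q?) x)) ([]=⇒lookup x∈)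
  ... | yes Qx | _  = Qx
  ... | no  _  | ()

⊈⇒∃∉ : ∀ {X Y : Subset k} → X ⊈ Y → ∃ λ x → x ∈ X × x ∉ Y
⊈⇒∃∉ {X = X} {Y} X⊈Y with any? (λ x → x ∈? X ×-dec ¬? (x ∈? Y))
... | yes found = found
... | no  none  = ⊥-elim (X⊈Y X⊆Y)
  where
  X⊆Y : X ⊆ Y
  X⊆Y {x} x∈X = decidable-stable (x ∈? Y) λ x∉Y → none (x , x∈X , x∉Y)

∈-allSubsets : ∀ k (X : Subset k) → X ∈ˡ allSubsets k
∈-allSubsets zero    Vec.[]          = Any.here refl
∈-allSubsets (suc k) (inside  ∷ X) = ∈-++⁺ˡ (∈-map⁺ (inside ∷_) (∈-allSubsets k X))
∈-allSubsets (suc k) (outside ∷ X) = ∈-++⁺ʳ _ (∈-map⁺ (outside ∷_) (∈-allSubsets k X))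

inside∷⊈outside∷ : ∀ {X Y : Subset k} → inside ∷ X ⊈ outside ∷ Y
inside∷⊈outside∷ X⊆Y with X⊆Y here
... | ()

∷-⊈ : ∀ b {X Y : Subset k} → X ⊈ Y → b ∷ X ⊈ b ∷ Y
∷-⊈ _ X⊈Y = X⊈Y ∘ drop-∷-⊆

allSubsets-⊈ : ∀ k → AllPairs _⊈_ (allSubsets k)
allSubsets-⊈ zero    = All.[] AllPairs.∷ AllPairs.[]
allSubsets-⊈ (suc k) =
  AllPairs.++⁺ (AllPairs.map⁺ (AllPairs.map (∷-⊈ inside)  (allSubsets-⊈ k)))
               (AllPairs.map⁺ (AllPairs.map (∷-⊈ outside) (allSubsets-⊈ k)))
               (All.map⁺ (All.universal (λ _ →
                  All.map⁺ (All.universal (λ _ → inside∷⊈outside∷) S)) S))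
  where S = allSubsets k

module UpSets (P : FinPoset) where

  open FinPoset P using () renaming (m to ∣P∣; _⊑_ to _≼_; _⊑?_ to _≼?_)
  open IsPartialOrder (isPartialOrder P)
    using () renaming (refl to ≼-refl; trans to ≼-trans; antisym to ≼-antisym)

  IsUpSet : Pred (Subset ∣P∣) _
  IsUpSet X = ∀ x y → x ∈ X → x ≼ y → y ∈ X

  isUpSet? : Decidable IsUpSet
  isUpSet? X = all? λ x → all? λ y → x ∈? X →-dec (x ≼? y →-dec y ∈? X)

  Above : Subset ∣P∣ → Pred (Fin ∣P∣) _
  Above X y = ∃ λ x → x ∈ X × x ≼ y

  above? : ∀ X → Decidable (Above X)
  above? X y = any? λ x → x ∈? X ×-dec x ≼? y

  ↑_ : Subset ∣P∣ → Subset ∣P∣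
  ↑ X = toSubset (above? X)

  ∈-↑⁺ : ∀ {X x y} → x ∈ X → x ≼ y → y ∈ ↑ X
  ∈-↑⁺ {X} x∈X x≼y = ∈-toSubset⁺ (above? X) (_ , x∈X , x≼y)

  ∈-↑⁻ : ∀ {X y} → y ∈ ↑ X → Above X y
  ∈-↑⁻ {X} = ∈-toSubset⁻ (above? X)

  ↑-isUpSet : ∀ X → IsUpSet (↑ X)
  ↑-isUpSet X y z y∈↑X y≼z =
    let x , x∈X , x≼y = ∈-↑⁻ y∈↑X in ∈-↑⁺ x∈X (≼-trans x≼y y≼z)

  antichain-⊆ : ∀ {X Y} → IsAntichain P X → ↑ X ≡ ↑ Y → X ⊆ Y
  antichain-⊆ {X} {Y} X-antichain ↑X≡↑Y {x} x∈X
    with ∈-↑⁻ {Y} (subst (x ∈_) ↑X≡↑Y (∈-↑⁺ x∈X ≼-refl))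
  ... | y , y∈Y , y≼x with ∈-↑⁻ {X} (subst (y ∈_) (sym ↑X≡↑Y) (∈-↑⁺ y∈Y ≼-refl))
  ... | x′ , x′∈X , x′≼y with x′ ≟ x
  ...   | yes refl = subst (_∈ Y) (≼-antisym y≼x x′≼y) y∈Y
  ...   | no  x′≢x = contradiction (≼-trans x′≼y y≼x) (X-antichain x′ x x′∈X x∈X x′≢x)

  ↑-injective : ∀ {X Y} → IsAntichain P X → IsAntichain P Y → ↑ X ≡ ↑ Y → X ≡ Y
  ↑-injective X-antichain Y-antichain ↑X≡↑Y =
    ⊆-antisym (antichain-⊆ X-antichain ↑X≡↑Y) (antichain-⊆ Y-antichain (sym ↑X≡↑Y))

  antichains upSets : List (Subset ∣P∣)
  antichains = filter (isAntichain? P) (allSubsets ∣P∣)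
  upSets     = filter isUpSet? (allSubsets ∣P∣)

  upSets-isUpSet : All IsUpSet upSets
  upSets-isUpSet = all-filter isUpSet? (allSubsets ∣P∣)

  upSets-⊈ : AllPairs _⊈_ upSets
  upSets-⊈ = AllPairs.filter⁺ isUpSet? (allSubsets-⊈ ∣P∣)

  numAntichains≤length-upSets : numAntichains P ≤ length upSets
  numAntichains≤length-upSets =
    length-≤-injection ↑_ antichains-distinct ↑∈upSets ↑-injective-on-antichains
    where
    antichains-distinct : AllPairs _≢_ antichains
    antichains-distinct = AllPairs.filter⁺ (isAntichain? P)
      (AllPairs.map (λ X⊈Y → X⊈Y ∘ ⊆-reflexive) (allSubsets-⊈ ∣P∣))
    ↑∈upSets : ∀ {X} → X ∈ˡ antichains → ↑ X ∈ˡ upSets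
    ↑∈upSets _ = ∈-filter⁺ isUpSet? (∈-allSubsets ∣P∣ _) (↑-isUpSet _)
    ↑-injective-on-antichains : ∀ {X Y} → X ∈ˡ antichains → Y ∈ˡ antichains →
                                ↑ X ≡ ↑ Y → X ≡ Y
    ↑-injective-on-antichains X∈ Y∈ =
      ↑-injective (proj₂ (∈-filter⁻ (isAntichain? P) {xs = allSubsets ∣P∣} X∈))
                  (proj₂ (∈-filter⁻ (isAntichain? P) {xs = allSubsets ∣P∣} Y∈))

  module _ (G : Digraph) where

    upSetLabelling⇒PColorable : (U : Vertex G → Subset ∣P∣) → (∀ v → IsUpSet (U v)) →
                                (∀ {u v} → _⇒_ G u v → U v ⊈ U u) → PColorable G P
    upSetLabelling⇒PColorable U U-isUpSet U-⊈ = colour , proper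
      where
      colour : ∀ u v → _⇒_ G u v → Fin ∣P∣
      colour u v e = proj₁ (⊈⇒∃∉ (U-⊈ e))

      proper : IsPColoring G P colour
      proper u v w e₁ e₂ c₁≼c₂ =
        let _ , c₁∈Uv , _    = ⊈⇒∃∉ (U-⊈ e₁)
            _ , _    , c₂∉Uv = ⊈⇒∃∉ (U-⊈ e₂)
        in c₂∉Uv (U-isUpSet v _ _ c₁∈Uv c₁≼c₂)

module Heights (G : Digraph) where

  open Digraph G using () renaming (_⇒_ to _⟶_)

  _⟶?_ : ∀ u v → Dec (u ⟶ v)
  u ⟶? v = T? (adj G u v)

  data WalkFrom : Vertex G → ℕ → Set where
    []  : ∀ {u} → WalkFrom u 0
    _∷_ : ∀ {u v L} → u ⟶ v → WalkFrom v L → WalkFrom u (suc L)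

  vertices : ∀ {u L} → WalkFrom u L → Fin (suc L) → Vertex G
  vertices {u} _       fzero    = u
  vertices     (_ ∷ p) (fsuc i) = vertices p i

  steps : ∀ {u L} (p : WalkFrom u L) (i : Fin L) → vertices p (inject₁ i) ⟶ vertices p (fsuc i)
  steps (e ∷ _) fzero    = e
  steps (_ ∷ p) (fsuc i) = steps p i

  toWalk : ∀ {u L} → WalkFrom u L → Walk G L
  toWalk p = vertices p , steps p

  successors : Vertex G → List (Vertex G)
  successors u = filter (u ⟶?_) (allFin (n G))

  height : ℕ → Vertex G → ℕ
  height zero    u = 0
  height (suc k) u = max 0 (map (suc ∘ height k) (successors u))

  walkOfHeight : ∀ k u → WalkFrom u (height k u)
  walkOfHeight zero    u = []
  walkOfHeight (suc k) u = argmax-all id {P = WalkFrom u} []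
    (All.map⁺ (All.map (λ {v} e → e ∷ walkOfHeight k v) (all-filter (u ⟶?_) (allFin (n G)))))

  height-step : ∀ {k u v} → u ⟶ v → suc (height k v) ≤ height (suc k) u
  height-step {k} {u} {v} e =
    All.lookup (xs≤max 0 _) (∈-map⁺ (suc ∘ height k) (∈-filter⁺ (u ⟶?_) (∈-allFin v) e))

  walk≤height : ∀ {k u L} → WalkFrom u L → L ≤ k → L ≤ height k u
  walk≤height         []      _         = z≤n
  walk≤height {suc k} (e ∷ p) (s≤s L≤k) = ≤-trans (s≤s (walk≤height p L≤k)) (height-step {k} e)

  WalksShorterThan : ℕ → Set
  WalksShorterThan K = ∀ {u L} → WalkFrom u L → L < K

  height<bound : ∀ {K} → WalksShorterThan K → ∀ u → height K u < K
  height<bound {K} bounded u = bounded (walkOfHeight K u)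

  height-decreasing : ∀ {K} → WalksShorterThan K → ∀ {u v} → u ⟶ v → height K v < height K u
  height-decreasing {zero}  bounded {u} _ = contradiction (bounded ([] {u})) λ ()
  height-decreasing {suc K} bounded {v = v} e = ≤-trans (s≤s height-v≤K) (height-step {K} e)
    where
    height-v≤K : height (suc K) v ≤ height K v
    height-v≤K = walk≤height (walkOfHeight (suc K) v)
                             (<⇒≤ (s<s⁻¹ (bounded (e ∷ walkOfHeight (suc K) v))))

mainTheorem13 : (G : Digraph) (P : FinPoset) →
    -- length(G) + 1 ≤ |A(P)|: every walk (so G is acyclic and its
    -- maximal walk length) has length L with L + 1 ≤ |A(P)|
    (∀ (L : ℕ) → Walk G L → suc L ≤ numAntichains P) →
    PColorable G P
mainTheorem13 G P walks-short = upSetLabelling⇒PColorable G U U-isUpSet U-⊈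
  where
  open UpSets P
  open Heights G

  bounded : WalksShorterThan (numAntichains P)
  bounded p = walks-short _ (toWalk p)

  level : Vertex G → Fin (length upSets)
  level v = fromℕ< (<-≤-trans (height<bound bounded v) numAntichains≤length-upSets)

  U : Vertex G → Subset (m P)
  U = lookup upSets ∘ level

  U-isUpSet : ∀ v → IsUpSet (U v)
  U-isUpSet v = All.lookup upSets-isUpSet (∈-lookup (level v))

  U-⊈ : ∀ {u v} → _⇒_ G u v → U v ⊈ U u
  U-⊈ e = AllPairs-lookup upSets-⊈
    (subst₂ _<_ (sym (toℕ-fromℕ< _)) (sym (toℕ-fromℕ< _)) (height-decreasing bounded e))
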